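{- Let $f(N)$ denote the largest size of a set $A\subseteq[N]$ with distinct subset products. Then there is a constant $C$ such that for all $N\in\mathbb{N}$, $$f(N)\ge \pi(N)+\pi(N^{1/2})+\tfrac13\pi(N^{1/3})-C.$$
   Context: A finite set $A\subset\mathbb{N}$ has distinct subset products if for any two distinct subsets $B,C\subseteq A$ we have $\prod_{b\in B}b\neq\prod_{c\in C}c$. $\pi(x)$ denotes the number of primes $\le x$, and $[N]=\{1,\dots,N\}$. -}

module Defs where

open import Data.Nat using (ℕ; zero; suc; _*_; _^_; _≤_; _≤?_)
open import Data.Bool using (Bool; true; false)
open import Data.List using (List; []; _∷_; length; filter; upTo)
open import Data.List.Relation.Unary.All using (All)
open import Data.List.Relation.Unary.Unique.Propositional using (Unique)
open import Data.Vec using (Vec; []; _∷_)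
open import Data.Nat.Primality using (Prime; prime?)
open import Data.Product using (Σ; _×_; _,_)
open import Relation.Nullary.Decidable using (_×-dec_)
open import Relation.Binary.PropositionalEquality using (_≡_)
open import Relation.Nullary using (¬_)

-- A subset B of (the elements of) a duplicate-free list A is given by a
-- membership mask; subsetProduct A B is the product of the selected elements.
subsetProduct : (A : List ℕ) → Vec Bool (length A) → ℕ
subsetProduct []      []          = 1
subsetProduct (a ∷ A) (true  ∷ B) = a * subsetProduct A B
subsetProduct (a ∷ A) (false ∷ B) = subsetProduct A B

DistinctSubsetProducts : List ℕ → Set
DistinctSubsetProducts A =
  (B C : Vec Bool (length A)) → ¬ (B ≡ C) → ¬ (subsetProduct A B ≡ subsetProduct A C)

SubsetOf[_] : ℕ → List ℕ → Set
SubsetOf[ N ] A = Unique A × All (λ a → 1 ≤ a × a ≤ N) A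

-- "f(N) ≥ k": there is A ⊆ [N] with distinct subset products and |A| ≥ k.
fAtLeast : ℕ → ℕ → Set
fAtLeast N k = Σ (List ℕ) λ A → SubsetOf[ N ] A × DistinctSubsetProducts A × k ≤ length A

-- π(N^{1/k}) = #{ primes p : p ≤ N^{1/k} } = #{ primes p ≤ N : p^k ≤ N }   (k ≥ 1)
πRoot : ℕ → ℕ → ℕ
πRoot k N = length (filter (λ p → prime? p ×-dec (p ^ k ≤? N)) (upTo (suc N)))

π : ℕ → ℕ
π N = πRoot 1 N

-- A prime p ≤ N contributes {p} if N < p², and {p, p²} if p² ≤ N < p³; the primes with p³ ≤ N
-- are taken in threes p, q, r, each triple contributing the seven monomials r, r², qr², q³, pr²,
-- pq, p³ (at most two primes are left over and contribute {p, p²}). The 2⁷ subset sums of these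
-- exponent vectors are pairwise distinct, so inside a block a subset product determines the
-- subset. Different blocks use disjoint sets of primes, and a·b = c·d with a ⊥ d and c ⊥ b
-- forces a = c and b = d, so a subset product of the union determines its part in every block.
-- Each prime p adds 3 + 3·[p² ≤ N] + [p³ ≤ N] to 3π(N) + 3π(N^(1/2)) + π(N^(1/3)), which is three
-- times its share of the set, except that a leftover prime falls short by 1; hence C = 1.

module Submission where

open import Defs
open import Data.Nat using (ℕ; _+_; _*_; _≤_)
open import Data.List using (List; length)
open import Data.Product using (Σ; _×_)

open import Data.Bool using (Bool; true; false)
import Data.Bool.Properties as Bool
open import Data.Fin.Subset using (⊥; ⁅_⁆)
open import Data.Fin.Subset.Properties using (anySubset?)
open import Data.List using ([]; _∷_; _++_; map; concatMap; filter; upTo)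
open import Data.List.Membership.Propositional using (_∈_)
open import Data.List.Membership.Propositional.Properties using (∈-filter⁻)
open import Data.List.Properties using (length-map; length-++; concatMap-++)
open import Data.List.Relation.Binary.Disjoint.Propositional using (Disjoint)
open import Data.List.Relation.Unary.All as All using (All; []; _∷_; all?)
open import Data.List.Relation.Unary.All.Properties
  using (map⁺; ++⁺; ++⁻ˡ; ++⁻ʳ; all-filter; concat⁺)
open import Data.List.Relation.Unary.AllPairs using (AllPairs; []; _∷_)
open import Data.List.Relation.Unary.Any using (here; there; index)
open import Data.List.Relation.Unary.Unique.Propositional using (Unique)
import Data.List.Relation.Unary.Unique.Propositional.Properties as Unique
open import Data.Nat
  using (suc; zero; z≤n; _^_; _<_; _⊔_; _≤?_; NonZero; >-nonZero; >-nonZero⁻¹; nonTrivial⇒n>1)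
open import Data.Nat.Coprimality as Coprime
  using (Coprime; coprime-divisor; 1-coprimeTo; prime⇒coprime)
open import Data.Nat.Divisibility using (_∣_; ∣-trans; ∣-antisym; m∣m*n; n∣m*n)
open import Data.Nat.Primality using (Prime; prime?; prime⇒nonZero; prime⇒nonTrivial)
open import Data.Nat.Properties
open import Algebra.Properties.CommutativeSemigroup *-commutativeSemigroup using (interchange)
open import Data.Nat.Tactic.RingSolver using (solve-∀)
open import Data.Product using (_,_; ∃; ∃₂; proj₁; proj₂)
open import Data.Vec using (Vec; []; _∷_; replicate; zipWith; cast; sum)
import Data.Vec.Properties as Vec
open import Function using (_∘_)
open import Relation.Binary.Definitions using (tri<; tri≈; tri>)
open import Relation.Binary.PropositionalEquality
open import Relation.Nullary using (¬_; Dec; yes; no; ¬?; contradiction; map′)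
open import Relation.Nullary.Decidable using (_×-dec_; decidable-stable; from-yes)
open import Relation.Unary using (Decidable)

private
  variable
    a b c d i j k m n o p q r N : ℕ
    X Y : List ℕ

coprime-*ʳ : Coprime m n → Coprime m o → Coprime m (n * o)
coprime-*ʳ m⊥n m⊥o (d∣m , d∣n*o) =
  m⊥o (d∣m , coprime-divisor (λ (e∣d , e∣n) → m⊥n (∣-trans e∣d d∣m , e∣n)) d∣n*o)

coprime-^ʳ : Coprime m n → ∀ k → Coprime m (n ^ k)
coprime-^ʳ {m} _   zero    = Coprime.sym (1-coprimeTo m)
coprime-^ʳ     m⊥n (suc k) = coprime-*ʳ m⊥n (coprime-^ʳ m⊥n k)

distinctPrimes⇒coprime : Prime p → Prime q → p ≢ q → Coprime p q
distinctPrimes⇒coprime {p} {q} pp pq p≢q with <-cmp p q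
... | tri< p<q _ _ = Coprime.sym (prime⇒coprime pq {{prime⇒nonZero pp}} p<q)
... | tri≈ _ p≡q _ = contradiction p≡q p≢q
... | tri> _ _ q<p = prime⇒coprime pp {{prime⇒nonZero pq}} q<p

distinctPrimes⇒pairwiseCoprime : ∀ {ps} → All Prime ps → Unique ps → AllPairs Coprime ps
distinctPrimes⇒pairwiseCoprime []         []           = []
distinctPrimes⇒pairwiseCoprime (pp ∷ pps) (p∉ps ∷ ups) =
  All.zipWith (λ (pq , p≢q) {_} → distinctPrimes⇒coprime pp pq p≢q) (pps , p∉ps)
  ∷ distinctPrimes⇒pairwiseCoprime pps ups

coprime-factorisation-unique : Coprime a d → Coprime c b → a * b ≡ c * d → a ≡ c × b ≡ d
coprime-factorisation-unique {a} {d} {c} {b} a⊥d c⊥b ab≡cd =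
  ∣-antisym (coprime-divisor a⊥d (subst (a ∣_) (trans ab≡cd (*-comm c d)) (m∣m*n b)))
            (coprime-divisor c⊥b (subst (c ∣_) (trans (sym ab≡cd) (*-comm a b)) (m∣m*n d))) ,
  ∣-antisym (coprime-divisor (Coprime.sym c⊥b) (subst (b ∣_) ab≡cd (n∣m*n a)))
            (coprime-divisor (Coprime.sym a⊥d) (subst (d ∣_) (sym ab≡cd) (n∣m*n c)))

^-cancelˡ-≡ : 1 < m → m ^ i ≡ m ^ j → i ≡ j
^-cancelˡ-≡ {m} {i} {j} 1<m mⁱ≡mʲ with <-cmp i j
... | tri< i<j _ _ = contradiction mⁱ≡mʲ (<⇒≢ (^-monoʳ-< m 1<m i<j))
... | tri≈ _ i≡j _ = i≡j
... | tri> _ _ j<i = contradiction (sym mⁱ≡mʲ) (<⇒≢ (^-monoʳ-< m 1<m j<i))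

Mask : {A : Set} → List A → Set
Mask A = Vec Bool (length A)

coprime-subsetProduct : ∀ {A} → All (Coprime m) A → (B : Mask A) → Coprime m (subsetProduct A B)
coprime-subsetProduct {m} []          []          = Coprime.sym (1-coprimeTo m)
coprime-subsetProduct     (m⊥a ∷ m⊥A) (true  ∷ B) = coprime-*ʳ m⊥a (coprime-subsetProduct m⊥A B)
coprime-subsetProduct     (_   ∷ m⊥A) (false ∷ B) = coprime-subsetProduct m⊥A B

distinctSubsetProducts⇒injective : ∀ A → DistinctSubsetProducts A →
  (B C : Mask A) → subsetProduct A B ≡ subsetProduct A C → B ≡ C
distinctSubsetProducts⇒injective _ distinct B C eq =
  decidable-stable (Vec.≡-dec Bool._≟_ B C) (λ B≢C → distinct B C B≢C eq)

joinMask : ∀ X → Mask X → Mask Y → Mask (X ++ Y)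
joinMask []      []       B₂ = B₂
joinMask (_ ∷ X) (b ∷ B₁) B₂ = b ∷ joinMask X B₁ B₂

splitMask : ∀ X (B : Mask (X ++ Y)) → ∃₂ λ B₁ B₂ → B ≡ joinMask X B₁ B₂
splitMask []      B       = [] , B , refl
splitMask (_ ∷ X) (b ∷ B) with splitMask X B
... | B₁ , B₂ , refl = b ∷ B₁ , B₂ , refl

subsetProduct-joinMask : ∀ X (B₁ : Mask X) (B₂ : Mask Y) →
  subsetProduct (X ++ Y) (joinMask X B₁ B₂) ≡ subsetProduct X B₁ * subsetProduct Y B₂
subsetProduct-joinMask []      []           B₂ = sym (*-identityˡ _)
subsetProduct-joinMask (x ∷ X) (true  ∷ B₁) B₂ =
  trans (cong (x *_) (subsetProduct-joinMask X B₁ B₂)) (sym (*-assoc x _ _))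
subsetProduct-joinMask (x ∷ X) (false ∷ B₁) B₂ = subsetProduct-joinMask X B₁ B₂

distinctSubsetProducts-++ : ∀ X Y → DistinctSubsetProducts X → DistinctSubsetProducts Y →
  (∀ B C → Coprime (subsetProduct X B) (subsetProduct Y C)) → DistinctSubsetProducts (X ++ Y)
distinctSubsetProducts-++ X Y distinctX distinctY coprime B C B≢C eq
  with splitMask X B | splitMask X C
... | B₁ , B₂ , refl | C₁ , C₂ , refl
  with coprime-factorisation-unique (coprime B₁ C₂) (coprime C₁ B₂)
         (trans (sym (subsetProduct-joinMask X B₁ B₂)) (trans eq (subsetProduct-joinMask X C₁ C₂)))
... | X₁≡X₂ , Y₁≡Y₂ =
  B≢C (cong₂ (joinMask X) (distinctSubsetProducts⇒injective X distinctX B₁ C₁ X₁≡X₂)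
                          (distinctSubsetProducts⇒injective Y distinctY B₂ C₂ Y₁≡Y₂))

subsetProduct-⊥ : ∀ A → subsetProduct A ⊥ ≡ 1
subsetProduct-⊥ []      = refl
subsetProduct-⊥ (_ ∷ A) = subsetProduct-⊥ A

subsetProduct-⁅⁆ : ∀ {x A} (x∈A : x ∈ A) → subsetProduct A ⁅ index x∈A ⁆ ≡ x
subsetProduct-⁅⁆ {x} {_ ∷ A} (here refl) = trans (cong (x *_) (subsetProduct-⊥ A)) (*-identityʳ x)
subsetProduct-⁅⁆             (there x∈A) = subsetProduct-⁅⁆ x∈A

distinctSubsetProducts⇒unique : ∀ A → DistinctSubsetProducts A → Unique A
distinctSubsetProducts⇒unique []      _        = []
distinctSubsetProducts⇒unique (a ∷ A) distinct =
  All.tabulate a∉A ∷ distinctSubsetProducts⇒unique A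
    (λ B C B≢C → distinct (false ∷ B) (false ∷ C) (B≢C ∘ Vec.∷-injectiveʳ))
  where
  a∉A : ∀ {x} → x ∈ A → a ≢ x
  a∉A x∈A refl = distinct (true ∷ ⊥) (false ∷ ⁅ index x∈A ⁆) (λ ())
    (trans (cong (a *_) (subsetProduct-⊥ A)) (trans (*-identityʳ a) (sym (subsetProduct-⁅⁆ x∈A))))

monomial : (ps : List ℕ) → Vec ℕ (length ps) → ℕ
monomial []       []      = 1
monomial (p ∷ ps) (a ∷ u) = p ^ a * monomial ps u

monomial-0 : ∀ ps → monomial ps (replicate _ 0) ≡ 1
monomial-0 []       = refl
monomial-0 (_ ∷ ps) = trans (+-identityʳ _) (monomial-0 ps)

monomial-+ : ∀ ps u v → monomial ps (zipWith _+_ u v) ≡ monomial ps u * monomial ps v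
monomial-+ []       []      []      = refl
monomial-+ (p ∷ ps) (a ∷ u) (b ∷ v) = begin
  p ^ (a + b) * monomial ps (zipWith _+_ u v)
    ≡⟨ cong₂ _*_ (^-distribˡ-+-* p a b) (monomial-+ ps u v) ⟩
  p ^ a * p ^ b * (monomial ps u * monomial ps v)
    ≡⟨ interchange (p ^ a) (p ^ b) (monomial ps u) (monomial ps v) ⟩
  p ^ a * monomial ps u * (p ^ b * monomial ps v) ∎
  where open ≡-Reasoning

coprime-monomial : ∀ {ps} → All (Coprime m) ps → ∀ u → Coprime m (monomial ps u)
coprime-monomial {m} []           []      = Coprime.sym (1-coprimeTo m)
coprime-monomial     (m⊥p ∷ m⊥ps) (a ∷ u) =
  coprime-*ʳ (coprime-^ʳ m⊥p a) (coprime-monomial m⊥ps u)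

monomial-injective : ∀ {ps} → All (1 <_) ps → AllPairs Coprime ps →
  ∀ u v → monomial ps u ≡ monomial ps v → u ≡ v
monomial-injective []           []            []      []      _  = refl
monomial-injective {p ∷ ps} (1<p ∷ 1<ps) (p⊥ps ∷ ⊥ps) (a ∷ u) (b ∷ v) eq =
  cong₂ _∷_ (^-cancelˡ-≡ 1<p (proj₁ factors)) (monomial-injective 1<ps ⊥ps u v (proj₂ factors))
  where
  pᵏ⊥ : ∀ k w → Coprime (p ^ k) (monomial ps w)
  pᵏ⊥ k w = Coprime.sym (coprime-^ʳ (Coprime.sym (coprime-monomial p⊥ps w)) k)
  factors = coprime-factorisation-unique (pᵏ⊥ a v) (pᵏ⊥ b u) eq

monomial-positive : ∀ {ps} → All NonZero ps → ∀ u → 0 < monomial ps u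
monomial-positive []           []      = ≤-refl
monomial-positive {p ∷ _} (p≢0 ∷ ps≢0) (a ∷ u) =
  *-mono-≤ (m^n>0 p {{p≢0}} a) (monomial-positive ps≢0 u)

monomial-≤ : ∀ {ps} → All (_≤ m) ps → ∀ u → monomial ps u ≤ m ^ sum u
monomial-≤         []           []      = ≤-refl
monomial-≤ {m} {p ∷ ps} (p≤m ∷ ps≤m) (a ∷ u) = begin
  p ^ a * monomial ps u  ≤⟨ *-mono-≤ (^-monoˡ-≤ a p≤m) (monomial-≤ ps≤m u) ⟩
  m ^ a * m ^ sum u      ≡⟨ ^-distribˡ-+-* m a (sum u) ⟨
  m ^ (a + sum u)        ∎
  where open ≤-Reasoning

subsetSum : (L : List (Vec ℕ n)) → Mask L → Vec ℕ n
subsetSum []      []          = replicate _ 0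
subsetSum (u ∷ L) (true  ∷ B) = zipWith _+_ u (subsetSum L B)
subsetSum (u ∷ L) (false ∷ B) = subsetSum L B

SubsetSumsDistinct : List (Vec ℕ n) → Set
SubsetSumsDistinct L = ∀ B C → subsetSum L B ≡ subsetSum L C → B ≡ C

subsetSumsDistinct? : (L : List (Vec ℕ n)) → Dec (SubsetSumsDistinct L)
subsetSumsDistinct? L = map′ fromNoCollision toNoCollision (¬? (anySubset? λ B → anySubset? λ C →
  ¬? (Vec.≡-dec Bool._≟_ B C) ×-dec Vec.≡-dec _≟_ (subsetSum L B) (subsetSum L C)))
  where
  Collision = ∃ λ B → ∃ λ C → B ≢ C × subsetSum L B ≡ subsetSum L C
  fromNoCollision : ¬ Collision → SubsetSumsDistinct L
  fromNoCollision none B C eq =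
    decidable-stable (Vec.≡-dec Bool._≟_ B C) (λ B≢C → none (B , C , B≢C , eq))
  toNoCollision : SubsetSumsDistinct L → ¬ Collision
  toNoCollision distinct (B , C , B≢C , eq) = B≢C (distinct B C eq)

cast-injective : ∀ {A : Set} .(eq : m ≡ n) {xs ys : Vec A m} → cast eq xs ≡ cast eq ys → xs ≡ ys
cast-injective eq {xs} {ys} castxs≡castys = trans (sym (Vec.cast-sym eq castxs≡castys))
  (trans (Vec.cast-trans eq (sym eq) ys) (Vec.cast-is-id _ ys))

subsetProduct-monomials : ∀ ps L (B : Mask (map (monomial ps) L)) →
  subsetProduct (map (monomial ps) L) B ≡
  monomial ps (subsetSum L (cast (length-map (monomial ps) L) B))
subsetProduct-monomials ps []      []          = sym (monomial-0 ps)
subsetProduct-monomials ps (u ∷ L) (true  ∷ B) =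
  trans (cong (monomial ps u *_) (subsetProduct-monomials ps L B)) (sym (monomial-+ ps u _))
subsetProduct-monomials ps (u ∷ L) (false ∷ B) = subsetProduct-monomials ps L B

monomials-distinctSubsetProducts : ∀ {ps} (L : List (Vec ℕ (length ps))) →
  All (1 <_) ps → AllPairs Coprime ps → SubsetSumsDistinct L →
  DistinctSubsetProducts (map (monomial ps) L)
monomials-distinctSubsetProducts {ps} L 1<ps ⊥ps distinct B C B≢C eq =
  B≢C (cast-injective (length-map (monomial ps) L) (distinct _ _ (monomial-injective 1<ps ⊥ps _ _
    (trans (sym (subsetProduct-monomials ps L B)) (trans eq (subsetProduct-monomials ps L C))))))

record Block : Set where
  constructor block
  field
    primes    : List ℕ
    exponents : List (Vec ℕ (length primes))

  elements : List ℕ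
  elements = map (monomial primes) exponents

open Block

support : List Block → List ℕ
support = concatMap primes

members : List Block → List ℕ
members = concatMap elements

coprime-elements : ∀ b → All (Coprime m) (primes b) → All (Coprime m) (elements b)
coprime-elements b m⊥b = map⁺ (All.universal (coprime-monomial m⊥b) (exponents b))

coprime-members : ∀ bs → All (Coprime m) (support bs) → All (Coprime m) (members bs)
coprime-members []       []  = []
coprime-members (b ∷ bs) m⊥ =
  ++⁺ (coprime-elements b (++⁻ˡ (primes b) m⊥)) (coprime-members bs (++⁻ʳ (primes b) m⊥))

disjointBlocks-coprime : ∀ b bs → All (λ p → All (Coprime p) (support bs)) (primes b) →
  ∀ B C → Coprime (subsetProduct (elements b) B) (subsetProduct (members bs) C)
disjointBlocks-coprime b bs b⊥bs B C =
  Coprime.sym (coprime-subsetProduct (coprime-elements b (All.map prime⊥bs b⊥bs)) B)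
  where
  prime⊥bs : All (Coprime p) (support bs) → Coprime (subsetProduct (members bs) C) p
  prime⊥bs p⊥bs = Coprime.sym (coprime-subsetProduct (coprime-members bs p⊥bs) C)

AllPairs-++⁻ : ∀ {A : Set} {R : A → A → Set} xs {ys} → AllPairs R (xs ++ ys) →
  AllPairs R xs × AllPairs R ys × All (λ x → All (R x) ys) xs
AllPairs-++⁻ []       Rys         = [] , Rys , []
AllPairs-++⁻ (x ∷ xs) (Rx ∷ Rxys) with AllPairs-++⁻ xs Rxys
... | Rxs , Rys , Rxsys = ++⁻ˡ xs Rx ∷ Rxs , Rys , ++⁻ʳ xs Rx ∷ Rxsys

blocks-distinctSubsetProducts : ∀ bs → All (1 <_) (support bs) → AllPairs Coprime (support bs) →
  All (SubsetSumsDistinct ∘ exponents) bs → DistinctSubsetProducts (members bs)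
blocks-distinctSubsetProducts []       _    _   []                     [] [] B≢C _ = B≢C refl
blocks-distinctSubsetProducts (b ∷ bs) 1<ps ⊥ps (distinct ∷ distincts)
  with AllPairs-++⁻ (primes b) ⊥ps
... | ⊥b , ⊥bs , b⊥bs = distinctSubsetProducts-++ (elements b) (members bs)
  (monomials-distinctSubsetProducts (exponents b) (++⁻ˡ (primes b) 1<ps) ⊥b distinct)
  (blocks-distinctSubsetProducts bs (++⁻ʳ (primes b) 1<ps) ⊥bs distincts)
  (disjointBlocks-coprime b bs b⊥bs)

RootPrime : ℕ → ℕ → ℕ → Set
RootPrime k N p = Prime p × p ^ k ≤ N

rootPrime? : ∀ k N → Decidable (RootPrime k N)
rootPrime? k N p = prime? p ×-dec (p ^ k ≤? N)

rootPrime-anti : j ≤ k → RootPrime k N p → RootPrime j N p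
rootPrime-anti {p = p} j≤k (pp , pᵏ≤N) = pp , ≤-trans (^-monoʳ-≤ p {{prime⇒nonZero pp}} j≤k) pᵏ≤N

primesUpToRoot : ℕ → ℕ → List ℕ
primesUpToRoot k N = filter (rootPrime? k N) (upTo (suc N))

betweenRoots? : ∀ j k N → Decidable (λ p → RootPrime j N p × ¬ RootPrime k N p)
betweenRoots? j k N p = rootPrime? j N p ×-dec ¬? (rootPrime? k N p)

primesBetweenRoots : ℕ → ℕ → ℕ → List ℕ
primesBetweenRoots j k N = filter (betweenRoots? j k N) (upTo (suc N))

length-filter-split : ∀ {A : Set} {P Q : A → Set} (P? : Decidable P) (Q? : Decidable Q) →
  (∀ {x} → Q x → P x) → ∀ xs →
  length (filter P? xs) ≡ length (filter Q? xs) + length (filter (λ x → P? x ×-dec ¬? (Q? x)) xs)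
length-filter-split P? Q? Q⇒P []       = refl
length-filter-split P? Q? Q⇒P (x ∷ xs) with P? x | Q? x | length-filter-split P? Q? Q⇒P xs
... | yes _  | yes _  | IH = cong suc IH
... | yes _  | no _   | IH = trans (cong suc IH) (sym (+-suc _ _))
... | no ¬Px | yes Qx | _  = contradiction (Q⇒P Qx) ¬Px
... | no _   | no _   | IH = IH

πRoot-split : ∀ N → j ≤ k → πRoot j N ≡ πRoot k N + length (primesBetweenRoots j k N)
πRoot-split {j} {k} N j≤k =
  length-filter-split (rootPrime? j N) (rootPrime? k N) (rootPrime-anti j≤k) (upTo (suc N))

filter-disjoint : ∀ {P : ℕ → Set} (P? : Decidable P) xs {ys} →
  All (¬_ ∘ P) ys → Disjoint (filter P? xs) ys
filter-disjoint P? xs ¬Pys (v∈P , v∈ys) =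
  All.lookup ¬Pys v∈ys (proj₂ (∈-filter⁻ P? {xs = xs} v∈P))

Admissible : ℕ → Block → Set
Admissible N b = SubsetSumsDistinct (exponents b) × All (λ a → 1 ≤ a × a ≤ N) (elements b)

elements-inRange : ∀ b m d → All Prime (primes b) → All (_≤ m) (primes b) → .{{NonZero m}} →
  m ^ d ≤ N → All ((_≤ d) ∘ sum) (exponents b) → All (λ a → 1 ≤ a × a ≤ N) (elements b)
elements-inRange b m d pps ps≤m mᵈ≤N degrees = map⁺ (All.map inRange degrees)
  where
  inRange : ∀ {u} → sum u ≤ d → 1 ≤ monomial (primes b) u × monomial (primes b) u ≤ _
  inRange {u} deg≤d = monomial-positive (All.map prime⇒nonZero pps) u ,
    ≤-trans (monomial-≤ ps≤m u) (≤-trans (^-monoʳ-≤ m deg≤d) mᵈ≤N)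

singleExponents : List (Vec ℕ 1)
singleExponents = (1 ∷ []) ∷ []

squareExponents : List (Vec ℕ 1)
squareExponents = (1 ∷ []) ∷ (2 ∷ []) ∷ []

-- r, r², qr², q³, pr², pq, p³
cubicExponents : List (Vec ℕ 3)
cubicExponents = (0 ∷ 0 ∷ 1 ∷ []) ∷ (0 ∷ 0 ∷ 2 ∷ []) ∷ (0 ∷ 1 ∷ 2 ∷ []) ∷ (0 ∷ 3 ∷ 0 ∷ []) ∷
                 (1 ∷ 0 ∷ 2 ∷ []) ∷ (1 ∷ 1 ∷ 0 ∷ []) ∷ (3 ∷ 0 ∷ 0 ∷ []) ∷ []

singleBlock : ℕ → Block
singleBlock p = block (p ∷ []) singleExponents

squareBlock : ℕ → Block
squareBlock p = block (p ∷ []) squareExponents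

cubicBlock : ℕ → ℕ → ℕ → Block
cubicBlock p q r = block (p ∷ q ∷ r ∷ []) cubicExponents

singleBlock-admissible : RootPrime 1 N p → Admissible N (singleBlock p)
singleBlock-admissible {p = p} (pp , p≤N) =
  from-yes (subsetSumsDistinct? singleExponents) ,
  elements-inRange (singleBlock p) p 1 (pp ∷ []) (≤-refl ∷ []) {{prime⇒nonZero pp}} p≤N
    (from-yes (all? ((_≤? 1) ∘ sum) singleExponents))

squareBlock-admissible : RootPrime 2 N p → Admissible N (squareBlock p)
squareBlock-admissible {p = p} (pp , p²≤N) =
  from-yes (subsetSumsDistinct? squareExponents) ,
  elements-inRange (squareBlock p) p 2 (pp ∷ []) (≤-refl ∷ []) {{prime⇒nonZero pp}} p²≤N
    (from-yes (all? ((_≤? 2) ∘ sum) squareExponents))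

⊔-^-lub : ∀ m n k → m ^ k ≤ N → n ^ k ≤ N → (m ⊔ n) ^ k ≤ N
⊔-^-lub {N} m n k mᵏ≤N nᵏ≤N =
  subst (_≤ N) (sym (mono-≤-distrib-⊔ {f = _^ k} (^-monoˡ-≤ k) m n)) (⊔-lub mᵏ≤N nᵏ≤N)

cubicBlock-admissible : RootPrime 3 N p → RootPrime 3 N q → RootPrime 3 N r →
  Admissible N (cubicBlock p q r)
cubicBlock-admissible {p = p} {q = q} {r = r} (pp , p³≤N) (pq , q³≤N) (pr , r³≤N) =
  from-yes (subsetSumsDistinct? cubicExponents) ,
  elements-inRange (cubicBlock p q r) (p ⊔ q ⊔ r) 3 (pp ∷ pq ∷ pr ∷ [])
    (≤-trans (m≤m⊔n p q) (m≤m⊔n _ r) ∷ ≤-trans (m≤n⊔m p q) (m≤m⊔n _ r) ∷ m≤n⊔m _ r ∷ [])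
    {{p⊔q⊔r≢0}} (⊔-^-lub (p ⊔ q) r 3 (⊔-^-lub p q 3 p³≤N q³≤N) r³≤N)
    (from-yes (all? ((_≤? 3) ∘ sum) cubicExponents))
  where
  p⊔q⊔r≢0 : NonZero (p ⊔ q ⊔ r)
  p⊔q⊔r≢0 = >-nonZero (≤-trans (>-nonZero⁻¹ r {{prime⇒nonZero pr}}) (m≤n⊔m _ r))

triples : List ℕ → List Block
triples (p ∷ q ∷ r ∷ ps) = cubicBlock p q r ∷ triples ps
triples ps               = map squareBlock ps

support-triples : ∀ ps → support (triples ps) ≡ ps
support-triples []               = refl
support-triples (p ∷ [])         = refl
support-triples (p ∷ q ∷ [])     = refl
support-triples (p ∷ q ∷ r ∷ ps) = cong (λ qs → p ∷ q ∷ r ∷ qs) (support-triples ps)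

triples-admissible : ∀ {ps} → All (RootPrime 3 N) ps → All (Admissible N) (triples ps)
triples-admissible []           = []
triples-admissible (p ∷ [])     = squareBlock-admissible (rootPrime-anti (n≤1+n 2) p) ∷ []
triples-admissible (p ∷ q ∷ []) =
  squareBlock-admissible (rootPrime-anti (n≤1+n 2) p) ∷
  squareBlock-admissible (rootPrime-anti (n≤1+n 2) q) ∷ []
triples-admissible (p ∷ q ∷ r ∷ ps) = cubicBlock-admissible p q r ∷ triples-admissible ps

triples-size : ∀ ps → 7 * length ps ≤ 3 * length (members (triples ps)) + 3
triples-size []               = z≤n
triples-size (p ∷ [])         = from-yes (7 ≤? 9)
triples-size (p ∷ q ∷ [])     = from-yes (14 ≤? 15)
triples-size (p ∷ q ∷ r ∷ ps) = begin
  7 * (3 + length ps)                           ≡⟨ *-distribˡ-+ 7 3 (length ps) ⟩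
  21 + 7 * length ps                            ≤⟨ +-monoʳ-≤ 21 (triples-size ps) ⟩
  21 + (3 * length (members (triples ps)) + 3)  ≡⟨ +-assoc 21 _ 3 ⟨
  21 + 3 * length (members (triples ps)) + 3    ≡⟨ cong (_+ 3) (*-distribˡ-+ 3 7 _) ⟨
  3 * (7 + length (members (triples ps))) + 3   ∎
  where open ≤-Reasoning

blocks : ℕ → List Block
blocks N = triples (primesUpToRoot 3 N)
        ++ map squareBlock (primesBetweenRoots 2 3 N)
        ++ map singleBlock (primesBetweenRoots 1 2 N)

support-map : ∀ (f : ℕ → Block) → (∀ p → primes (f p) ≡ p ∷ []) → ∀ ps → support (map f ps) ≡ ps
support-map f primes-f []       = refl
support-map f primes-f (p ∷ ps) = cong₂ _++_ (primes-f p) (support-map f primes-f ps)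

support-blocks : ∀ N → support (blocks N) ≡
  primesUpToRoot 3 N ++ primesBetweenRoots 2 3 N ++ primesBetweenRoots 1 2 N
support-blocks N = begin
  support (triples small ++ map squareBlock medium ++ map singleBlock large)
    ≡⟨ concatMap-++ primes (triples small) _ ⟩
  support (triples small) ++ support (map squareBlock medium ++ map singleBlock large)
    ≡⟨ cong (support (triples small) ++_) (concatMap-++ primes (map squareBlock medium) _) ⟩
  support (triples small) ++ support (map squareBlock medium) ++ support (map singleBlock large)
    ≡⟨ cong₂ _++_ (support-triples small)
         (cong₂ _++_ (support-map squareBlock (λ _ → refl) medium)
                     (support-map singleBlock (λ _ → refl) large)) ⟩
  small ++ medium ++ large ∎
  where
  open ≡-Reasoning
  small  = primesUpToRoot 3 N
  medium = primesBetweenRoots 2 3 N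
  large  = primesBetweenRoots 1 2 N

support-blocks-prime : ∀ N → All Prime (support (blocks N))
support-blocks-prime N rewrite support-blocks N =
  ++⁺ (All.map proj₁ (all-filter (rootPrime? 3 N) ≤N))
      (++⁺ (All.map (proj₁ ∘ proj₁) (all-filter (betweenRoots? 2 3 N) ≤N))
           (All.map (proj₁ ∘ proj₁) (all-filter (betweenRoots? 1 2 N) ≤N)))
  where ≤N = upTo (suc N)

support-blocks-unique : ∀ N → Unique (support (blocks N))
support-blocks-unique N rewrite support-blocks N =
  Unique.++⁺ (Unique.filter⁺ (rootPrime? 3 N) ≤N-unique)
    (Unique.++⁺ (Unique.filter⁺ (betweenRoots? 2 3 N) ≤N-unique)
                (Unique.filter⁺ (betweenRoots? 1 2 N) ≤N-unique)
      (filter-disjoint (betweenRoots? 2 3 N) ≤N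
        (All.map (λ (_ , ¬p²≤N) (p²≤N , _) → ¬p²≤N p²≤N) (all-filter (betweenRoots? 1 2 N) ≤N))))
    (filter-disjoint (rootPrime? 3 N) ≤N
      (++⁺ (All.map proj₂ (all-filter (betweenRoots? 2 3 N) ≤N))
           (All.map (λ (_ , ¬p²≤N) p³≤N → ¬p²≤N (rootPrime-anti (n≤1+n 2) p³≤N))
                    (all-filter (betweenRoots? 1 2 N) ≤N))))
  where
  ≤N = upTo (suc N)
  ≤N-unique = Unique.upTo⁺ (suc N)

blocks-admissible : ∀ N → All (Admissible N) (blocks N)
blocks-admissible N =
  ++⁺ (triples-admissible (all-filter (rootPrime? 3 N) ≤N))
      (++⁺ (map⁺ (All.map (squareBlock-admissible ∘ proj₁) (all-filter (betweenRoots? 2 3 N) ≤N)))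
           (map⁺ (All.map (singleBlock-admissible ∘ proj₁) (all-filter (betweenRoots? 1 2 N) ≤N))))
  where ≤N = upTo (suc N)

members-blocks-distinct : ∀ N → DistinctSubsetProducts (members (blocks N))
members-blocks-distinct N = blocks-distinctSubsetProducts (blocks N)
  (All.map (λ {p} pp → nonTrivial⇒n>1 p {{prime⇒nonTrivial pp}}) (support-blocks-prime N))
  (distinctPrimes⇒pairwiseCoprime (support-blocks-prime N) (support-blocks-unique N))
  (All.map proj₁ (blocks-admissible N))

length-members-++ : ∀ bs cs →
  length (members (bs ++ cs)) ≡ length (members bs) + length (members cs)
length-members-++ bs cs = trans (cong length (concatMap-++ elements bs cs)) (length-++ (members bs))

length-members-map : ∀ (f : ℕ → Block) c → (∀ p → length (elements (f p)) ≡ c) → ∀ ps →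
  length (members (map f ps)) ≡ c * length ps
length-members-map f c size []       = sym (*-zeroʳ c)
length-members-map f c size (p ∷ ps) = begin
  length (elements (f p) ++ members (map f ps))
    ≡⟨ length-++ (elements (f p)) ⟩
  length (elements (f p)) + length (members (map f ps))
    ≡⟨ cong₂ _+_ (size p) (length-members-map f c size ps) ⟩
  c + c * length ps
    ≡⟨ *-suc c (length ps) ⟨
  c * suc (length ps) ∎
  where open ≡-Reasoning

length-members-blocks : ∀ N → length (members (blocks N)) ≡
  length (members (triples (primesUpToRoot 3 N)))
    + (2 * length (primesBetweenRoots 2 3 N) + 1 * length (primesBetweenRoots 1 2 N))
length-members-blocks N =
  trans (length-members-++ (triples small) _) (cong (length (members (triples small)) +_)
    (trans (length-members-++ (map squareBlock medium) _)
      (cong₂ _+_ (length-members-map squareBlock 2 (λ _ → refl) medium)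
                 (length-members-map singleBlock 1 (λ _ → refl) large))))
  where
  small  = primesUpToRoot 3 N
  medium = primesBetweenRoots 2 3 N
  large  = primesBetweenRoots 1 2 N

weighted-count-≤ : ∀ s m l t → 7 * s ≤ 3 * t + 3 →
  3 * (s + m + l) + 3 * (s + m) + s ≤ 3 * (t + (2 * m + 1 * l)) + 3 * 1
weighted-count-≤ s m l t 7s≤3t+3 = begin
  3 * (s + m + l) + 3 * (s + m) + s  ≡⟨ lhs s m l ⟩
  7 * s + (6 * m + 3 * l)            ≤⟨ +-monoˡ-≤ _ 7s≤3t+3 ⟩
  3 * t + 3 + (6 * m + 3 * l)        ≡⟨ rhs t m l ⟩
  3 * (t + (2 * m + 1 * l)) + 3 * 1  ∎
  where
  open ≤-Reasoning
  lhs : ∀ s m l → 3 * (s + m + l) + 3 * (s + m) + s ≡ 7 * s + (6 * m + 3 * l)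
  lhs = solve-∀
  rhs : ∀ t m l → 3 * t + 3 + (6 * m + 3 * l) ≡ 3 * (t + (2 * m + 1 * l)) + 3 * 1
  rhs = solve-∀

weightedPrimeCount-≤-members : ∀ N →
  3 * π N + 3 * πRoot 2 N + πRoot 3 N ≤ 3 * length (members (blocks N)) + 3 * 1
weightedPrimeCount-≤-members N = begin
  3 * π N + 3 * πRoot 2 N + πRoot 3 N
    ≡⟨ cong₂ (λ x y → 3 * x + 3 * y + small) π≡ (πRoot-split N (n≤1+n 2)) ⟩
  3 * (small + medium + large) + 3 * (small + medium) + small
    ≤⟨ weighted-count-≤ small medium large cubic (triples-size (primesUpToRoot 3 N)) ⟩
  3 * (cubic + (2 * medium + 1 * large)) + 3 * 1
    ≡⟨ cong (λ x → 3 * x + 3 * 1) (length-members-blocks N) ⟨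
  3 * length (members (blocks N)) + 3 * 1 ∎
  where
  open ≤-Reasoning
  small  = πRoot 3 N
  medium = length (primesBetweenRoots 2 3 N)
  large  = length (primesBetweenRoots 1 2 N)
  cubic  = length (members (triples (primesUpToRoot 3 N)))
  π≡ : π N ≡ small + medium + large
  π≡ = trans (πRoot-split N (n≤1+n 1)) (cong (_+ large) (πRoot-split N (n≤1+n 2)))

theorem1p4 : Σ ℕ λ C → (N : ℕ) → Σ (List ℕ) λ A →
    SubsetOf[ N ] A × DistinctSubsetProducts A ×
    (3 * π N + 3 * πRoot 2 N + πRoot 3 N ≤ 3 * length A + 3 * C)
theorem1p4 = 1 , λ N →
  members (blocks N) ,
  (distinctSubsetProducts⇒unique _ (members-blocks-distinct N) ,
   concat⁺ (map⁺ (All.map proj₂ (blocks-admissible N)))) ,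
  members-blocks-distinct N ,
  weightedPrimeCount-≤-members N
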